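{- Let $\mathcal{A}$ be an Abox without equality assertions, let $\mathbb{S}=(\Delta,\mathcal{L},\mathcal{E})$ be a saturated $\mathbf{R}$-graph for $(\mathcal{T},\mathcal{A},\mathcal{M})$, let $a=_m A$ and $b=_m B$ both belong to $\mathcal{M}$, and let $\mathcal{I}$ be the interpretation induced by $\mathbb{S}$. Then $a$ and $b$ are syntactically equal if and only if $A^{\mathcal{I}}=B^{\mathcal{I}}$.
   Context: Concepts are $\mathcal{ALC}$ concepts in negation normal form with standard semantics. $\mathcal{T}$ is a finite set of NNF concepts, $\mathcal{A}$ a finite set of assertions $C(a)$, $R(a,b)$, $a=b$, $a\neq b$, $\mathcal{M}$ a finite set of axioms $a=_m A$ ($a$ an individual, $A$ atomic). An $\mathbf{R}$-graph $(\Delta,\mathcal{L},\mathcal{E})$: $\Delta$ nonempty, $\mathcal{L}$ maps elements of $\Delta$ to sets of concepts, $\mathcal{E}$ maps roles to subsets of $\Delta\times\Delta$. It is saturated for $(\mathcal{T},\mathcal{A},\mathcal{M})$ if for all $x,y\in\Delta$: (1) $\neg C\in\mathcal{L}(x)\Rightarrow C\notin\mathcal{L}(x)$; (2) $C_1\sqcap C_2\in\mathcal{L}(x)\Rightarrow C_1,C_2\in\mathcal{L}(x)$; (3) $C_1\sqcup C_2\in\mathcal{L}(x)\Rightarrow C_1$ or $C_2\in\mathcal{L}(x)$; (4) $\forall R.C\in\mathcal{L}(x)$, $(x,y)\in\mathcal{E}(R)\Rightarrow C\in\mathcal{L}(y)$; (5) $\exists R.C\in\mathcal{L}(x)\Rightarrow\exists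 y$, $(x,y)\in\mathcal{E}(R)$, $C\in\mathcal{L}(y)$; (6) $C\in\mathcal{T}\Rightarrow C\in\mathcal{L}(x)$ for all $x$; (7) $\Delta$ contains all individuals of $\mathcal{A}$ and $\mathcal{M}$; (8) $C(a)\in\mathcal{A}\Rightarrow C\in\mathcal{L}(a)$; (9) $R(a,b)\in\mathcal{A}\Rightarrow(a,b)\in\mathcal{E}(R)$; (10) $a\neq b\in\mathcal{A}\Rightarrow a,b$ syntactically different; (11) no sequence $a_1=_m A_1,\dots,a_n=_m A_n$ ($n\ge1$) in $\mathcal{M}$ has $A_1\in\mathcal{L}(a_2),\dots,A_n\in\mathcal{L}(a_1)$; (12) $a=_m A,\ a=_m B\in\mathcal{M}\Rightarrow A=B$ syntactically; (13) if $a\neq b$ syntactically and $a=_m A,\ b=_m B\in\mathcal{M}$ then some $t\in\Delta$ has $(A\sqcap\neg B)\sqcup(B\sqcap\neg A)\in\mathcal{L}(t)$. The induced interpretation has domain $\Delta$, $A^{\mathcal{I}}=\{x\in\Delta\mid A\in\mathcal{L}(x)\}$ for atomic $A$, $R^{\mathcal{I}}=\mathcal{E}(R)$. -}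

module Defs where

open import Data.Nat using (ℕ)
open import Data.List using (List; []; _∷_)
open import Data.List.Membership.Propositional using (_∈_)
open import Data.List.Relation.Unary.All using (All)
open import Data.Product using (_×_; Σ; ∃; _,_)
open import Data.Sum using (_⊎_)
open import Relation.Nullary using (¬_)
open import Relation.Binary.PropositionalEquality using (_≡_; _≢_)
open import Level using (Level) renaming (suc to lsuc)

-- Names are natural numbers (so syntactic equality is decidable).
ConceptName : Set
ConceptName = ℕ

RoleName : Set
RoleName = ℕ

Individual : Set
Individual = ℕ

-- ALC concepts in negation normal form (negation only on atomic concepts).
data Concept : Set where
  ⊤ᶜ ⊥ᶜ    : Concept
  atom     : ConceptName → Concept
  neg      : ConceptName → Concept
  _⊓ᶜ_ _⊔ᶜ_  : Concept → Concept → Concept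
  all      : RoleName → Concept → Concept
  ex       : RoleName → Concept → Concept

data Assertion : Set where
  conceptAs : Concept → Individual → Assertion
  roleAs    : RoleName → Individual → Individual → Assertion
  eqAs      : Individual → Individual → Assertion
  neqAs     : Individual → Individual → Assertion

TBox : Set
TBox = List Concept

ABox : Set
ABox = List Assertion

record MAxiom : Set where
  constructor _=ₘ_
  field
    ind  : Individual
    name : ConceptName

MBox : Set
MBox = List MAxiom

IsEqAssertion : Assertion → Set
IsEqAssertion (eqAs _ _) = Data.Unit.⊤ where import Data.Unit
IsEqAssertion _          = Data.Empty.⊥ where import Data.Empty

NoEquality : ABox → Set
NoEquality 𝒜 = All (λ α → ¬ IsEqAssertion α) 𝒜

-- R-graph: domain Δ (nonempty), labelling ℒ (as a membership predicate),
-- edges ℰ.  Individuals are elements of Δ via the map `indiv`.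
record RGraph (ℓ : Level) : Set (lsuc ℓ) where
  field
    Δ     : Set ℓ
    inhabited : Δ
    indiv : Individual → Δ
    ℒ     : Δ → Concept → Set ℓ
    ℰ     : RoleName → Δ → Δ → Set ℓ

module _ {ℓ : Level} (S : RGraph ℓ) where
  open RGraph S

  -- Condition (11) helper: the sequence (a₁=ₘA₁) (a₂=ₘA₂) … (aₙ=ₘAₙ) with
  -- Aᵢ ∈ ℒ(aᵢ₊₁) and Aₙ ∈ ℒ(a₁).  `Chain first x rest` : consecutive links along
  -- x ∷ rest, with the last element linking back to `first`'s individual.
  Chain : MAxiom → MAxiom → List MAxiom → Set ℓ
  Chain first x [] = ℒ (indiv (MAxiom.ind first)) (atom (MAxiom.name x))
  Chain first x (y ∷ rest) =
    ℒ (indiv (MAxiom.ind y)) (atom (MAxiom.name x)) × Chain first y rest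

  MCycle : MBox → Set ℓ
  MCycle ℳ = Σ MAxiom λ x → Σ (List MAxiom) λ rest →
               All (_∈ ℳ) (x ∷ rest) × Chain x x rest

  record Saturated (𝒯 : TBox) (𝒜 : ABox) (ℳ : MBox) : Set ℓ where
    field
      c1  : ∀ x A → ℒ x (neg A) → ¬ ℒ x (atom A)
      c2  : ∀ x C₁ C₂ → ℒ x (C₁ ⊓ᶜ C₂) → ℒ x C₁ × ℒ x C₂
      c3  : ∀ x C₁ C₂ → ℒ x (C₁ ⊔ᶜ C₂) → ℒ x C₁ ⊎ ℒ x C₂
      c4  : ∀ x y R C → ℒ x (all R C) → ℰ R x y → ℒ y C
      c5  : ∀ x R C → ℒ x (ex R C) → Σ Δ λ y → ℰ R x y × ℒ y C
      c6  : ∀ C → C ∈ 𝒯 → ∀ x → ℒ x C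
      -- (7) holds by construction: every individual denotes `indiv a ∈ Δ`.
      c8  : ∀ C a → conceptAs C a ∈ 𝒜 → ℒ (indiv a) C
      c9  : ∀ R a b → roleAs R a b ∈ 𝒜 → ℰ R (indiv a) (indiv b)
      c10 : ∀ a b → neqAs a b ∈ 𝒜 → a ≢ b
      c11 : ¬ MCycle ℳ
      c12 : ∀ a A B → (a =ₘ A) ∈ ℳ → (a =ₘ B) ∈ ℳ → A ≡ B
      c13 : ∀ a b A B → a ≢ b → (a =ₘ A) ∈ ℳ → (b =ₘ B) ∈ ℳ →
              Σ Δ λ t → ℒ t ((atom A ⊓ᶜ neg B) ⊔ᶜ (atom B ⊓ᶜ neg A))

  -- Extension of an atomic concept in the induced interpretation.
  ext : ConceptName → Δ → Set ℓ
  ext A x = ℒ x (atom A)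

  SameExt : ConceptName → ConceptName → Set ℓ
  SameExt A B = ∀ x → (ext A x → ext B x) × (ext B x → ext A x)

module Submission where

-- Forward direction: if a and b are the same individual, the two
-- mapping axioms a =ₘ A and a =ₘ B force A ≡ B by condition (12), and equal
-- names have equal extensions.  Backward direction: individual names are
-- naturals, so a ≡ b is decidable; if a ≢ b, condition (13) yields an element
-- t labelled with the symmetric difference (A ⊓ ¬B) ⊔ (B ⊓ ¬A).  Using the
-- clash-freeness and the ⊓/⊔ rules (1)-(3), t lies in exactly one of the
-- extensions of A and B, so they differ.

open import Defs
open import Level using (Level)
open import Data.Product using (_×_; _,_; proj₁; proj₂)
open import Data.Sum using (_⊎_; inj₁; inj₂)
open import Data.Nat using (_≟_)
open import Data.Empty using (⊥-elim)
open import Data.List.Membership.Propositional using (_∈_)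
open import Relation.Nullary using (¬_; yes; no)
open import Relation.Binary.PropositionalEquality using (_≡_; refl)

symDiff : ConceptName → ConceptName → Concept
symDiff A B = (atom A ⊓ᶜ neg B) ⊔ᶜ (atom B ⊓ᶜ neg A)

sameExt-refl : {ℓ : Level} (S : RGraph ℓ) (A : ConceptName) → SameExt S A A
sameExt-refl S A x = (λ p → p) , (λ p → p)

module _ {ℓ : Level} (S : RGraph ℓ) where
  open RGraph S

  -- Rules (1)-(3) of saturation, the only ones the separation argument uses.
  ClashFree : Set ℓ
  ClashFree = ∀ x A → ℒ x (neg A) → ¬ ℒ x (atom A)

  ConjRule : Set ℓ
  ConjRule = ∀ x C₁ C₂ → ℒ x (C₁ ⊓ᶜ C₂) → ℒ x C₁ × ℒ x C₂

  DisjRule : Set ℓ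
  DisjRule = ∀ x C₁ C₂ → ℒ x (C₁ ⊔ᶜ C₂) → ℒ x C₁ ⊎ ℒ x C₂

  notSubset : ClashFree → ConjRule → (A B : ConceptName) (t : Δ) →
              ℒ t (atom A ⊓ᶜ neg B) → ¬ (ext S A t → ext S B t)
  notSubset c1 c2 A B t l A⊆B =
    let (inA , notB) = c2 t _ _ l in c1 t B notB (A⊆B inA)

  symDiff-separates : ClashFree → ConjRule → DisjRule → (A B : ConceptName) (t : Δ) →
                      ℒ t (symDiff A B) → ¬ SameExt S A B
  symDiff-separates c1 c2 c3 A B t l same with c3 t _ _ l
  ... | inj₁ onlyA = notSubset c1 c2 A B t onlyA (proj₁ (same t))
  ... | inj₂ onlyB = notSubset c1 c2 B A t onlyB (proj₂ (same t))

sameIndividual⇒sameExt : {ℓ : Level} {𝒯 : TBox} {𝒜 : ABox} {ℳ : MBox} (S : RGraph ℓ) →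
                          Saturated S 𝒯 𝒜 ℳ → (a b : Individual) (A B : ConceptName) →
                          (a =ₘ A) ∈ ℳ → (b =ₘ B) ∈ ℳ → a ≡ b → SameExt S A B
sameIndividual⇒sameExt S sat a .a A B ma mb refl with Saturated.c12 sat a A B ma mb
... | refl = sameExt-refl S A

sameExt⇒sameIndividual : {ℓ : Level} {𝒯 : TBox} {𝒜 : ABox} {ℳ : MBox} (S : RGraph ℓ) →
                          Saturated S 𝒯 𝒜 ℳ → (a b : Individual) (A B : ConceptName) →
                          (a =ₘ A) ∈ ℳ → (b =ₘ B) ∈ ℳ → SameExt S A B → a ≡ b
sameExt⇒sameIndividual S sat a b A B ma mb same with a ≟ b
... | yes a≡b = a≡b
... | no a≢b =
  let (t , l) = c13 a b A B a≢b ma mb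
  in ⊥-elim (symDiff-separates S c1 c2 c3 A B t l same)
  where open Saturated sat

mainTheorem9 : {ℓ : Level} (𝒯 : TBox) (𝒜 : ABox) (ℳ : MBox) (S : RGraph ℓ) →
    NoEquality 𝒜 → Saturated S 𝒯 𝒜 ℳ →
    (a b : Individual) (A B : ConceptName) →
    (a =ₘ A) ∈ ℳ → (b =ₘ B) ∈ ℳ →
    (a ≡ b → SameExt S A B) × (SameExt S A B → a ≡ b)
mainTheorem9 𝒯 𝒜 ℳ S _ sat a b A B ma mb =
  sameIndividual⇒sameExt S sat a b A B ma mb , sameExt⇒sameIndividual S sat a b A B ma mb
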